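{- Fix $b\in\mathbb{N}$. Any $b$-pattern $P$ in which exactly one point is assigned a circle and all other points are assigned crosses is realizable in $L=\mathbb{N}\times\mathbb{N}$. Consequently, the graph $G_b$ is not connected.
   Context: Let $\mathbb{N}=\{1,2,3,\dots\}$ and $L=\mathbb{N}\times\mathbb{N}$. For $b\in\mathbb{N}$, $\gcd_b(r,s)=\max\{k\in\mathbb{N}: k\mid r \text{ and } k^b\mid s\}$, and $(r,s)\in L$ is $b$-visible if $\gcd_b(r,s)=1$, $b$-invisible otherwise. A $b$-pattern $P$ is obtained by fixing a positive integer $w$ and assigning to each $(r,s)\in L$ with $1\le r\le w$, $1\le s\le w^b$ either a circle, a cross, or neither. $P$ is realizable in $L$ if there exists $(u,v)\in L$ such that $(u+r,v+s)$ is $b$-visible whenever $(r,s)$ is assigned a circle and $b$-invisible whenever $(r,s)$ is assigned a cross. $G_b$ is the graph whose vertices are the $b$-visible points of $L$, with an edge between two such points whenever their Euclidean distance is $1$. -}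

module Defs where

open import Data.Nat using (ℕ; zero; suc; _+_; _*_; _^_; _≤_; ∣_-_∣)
open import Data.Nat.Divisibility using (_∣_)
open import Data.Product using (_×_; _,_; Σ; ∃)
open import Relation.Binary.PropositionalEquality using (_≡_)
open import Relation.Nullary using (¬_)

-- Points of L = ℕ₊ × ℕ₊, represented as pairs of naturals with both
-- coordinates ≥ 1 (predicate InL).
Point : Set
Point = ℕ × ℕ

InL : Point → Set
InL (r , s) = (1 ≤ r) × (1 ≤ s)

IsGcdB : ℕ → ℕ → ℕ → ℕ → Set
IsGcdB b r s g = (g ∣ r) × (g ^ b ∣ s) × (∀ k → k ∣ r → k ^ b ∣ s → k ≤ g)

Visible : ℕ → Point → Set
Visible b (r , s) = IsGcdB b r s 1

Invisible : ℕ → Point → Set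
Invisible b p = ¬ Visible b p

InBox : ℕ → ℕ → Point → Set
InBox b w (r , s) = (1 ≤ r) × (r ≤ w) × (1 ≤ s) × (s ≤ w ^ b)

SingleCircleRealizable : ℕ → ℕ → Point → Set
SingleCircleRealizable b w (r₀ , s₀) =
  Σ Point λ { (u , v) →
    InL (u , v) ×
    Visible b (u + r₀ , v + s₀) ×
    (∀ r s → InBox b w (r , s) → ¬ ((r , s) ≡ (r₀ , s₀)) →
       Invisible b (u + r , v + s)) }

-- Euclidean distance 1 between lattice points: squared distance is 1.
Adjacent : Point → Point → Set
Adjacent (r , s) (r' , s') =
  ∣ r - r' ∣ * ∣ r - r' ∣ + ∣ s - s' ∣ * ∣ s - s' ∣ ≡ 1

Vertex : ℕ → Point → Set
Vertex b p = InL p × Visible b p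

data Reachable (b : ℕ) : Point → Point → Set where
  here : ∀ {p} → Reachable b p p
  step : ∀ {p q t} → Vertex b q → Adjacent p q → Reachable b q t → Reachable b p t

Connected : ℕ → Set
Connected b = ∀ p q → Vertex b p → Vertex b q → Reachable b p q

{-# OPTIONS --safe #-}
-- Give every point p ≠ (r₀, s₀) of the box its own modulus k_p; the moduli 1 + i·N! (distinct
-- i ≤ N) are pairwise coprime and coprime to 1, …, N, where N bounds all differences of
-- coordinates in the box. By the Chinese remainder theorem choose u with k_p ∣ u + r and v
-- with k_p^b ∣ v + s; then (u + r, v + s) is b-invisible. For the points in the circle's column
-- the conditions k_p ∣ u + r₀ say K ∣ u + r₀, where K is the product of their moduli; imposing
-- u + r₀ ≡ K (mod K²) instead makes u + r₀ = U′K with U′ coprime to K, and asking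
-- v + s₀ ≡ 1 (mod U′) makes v + s₀ coprime to U′. It is coprime to each column modulus k_p as well, since it differs
-- from v + s (a multiple of k_p) by a nonzero number at most N. So the coordinates of
-- (u + r₀, v + s₀) are coprime and it is b-visible. In a 3 × 3 box with the circle in the middle
-- this visible point has no visible neighbour, so G_b is not connected.
module Submission where

open import Defs
open import Data.Nat.Base
open import Data.Nat.Properties
open import Data.Nat.Divisibility
open import Data.Nat.DivMod using (_%_; [m+kn]%n≡m%n; m<n⇒m%n≡m)
open import Data.Nat.Coprimality using (Coprime; coprime-divisor; coprime-Bézout; 1-coprimeTo)
  renaming (sym to coprime-sym)
open import Data.Nat.GCD using (module Bézout)
open import Data.Nat.ListAction using (product)
open import Data.Nat.ListAction.Properties using (∈⇒∣product; product≢0)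
open import Data.Nat.Tactic.RingSolver using (solve-∀)
open import Data.Product using (∃-syntax; _×_; _,_; proj₁; proj₂)
open import Data.Product.Properties using (≡-dec)
open import Data.Sum using (_⊎_; inj₁; inj₂)
open import Data.List.Base using (List; []; _∷_; map; filter; upTo; cartesianProduct)
open import Data.List.Membership.Propositional using (_∈_)
open import Data.List.Membership.Propositional.Properties
  using (∈-map⁺; ∈-filter⁺; ∈-filter⁻; ∈-upTo⁺; ∈-upTo⁻; ∈-cartesianProduct⁺; ∈-cartesianProduct⁻)
open import Data.List.Relation.Unary.All as All using (All; []; _∷_)
import Data.List.Relation.Unary.All.Properties as Allₚ
open import Data.List.Relation.Unary.AllPairs using (AllPairs; []; _∷_)
import Data.List.Relation.Unary.AllPairs.Properties as AllPairsₚ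
open import Data.List.Relation.Unary.Any using (here; there)
open import Data.List.Relation.Unary.Unique.Propositional using (Unique)
import Data.List.Relation.Unary.Unique.Propositional.Properties as Uniqueₚ
open import Function.Base using (_∘_; _on_)
open import Relation.Binary.Definitions using (tri<; tri≈; tri>)
open import Relation.Binary.PropositionalEquality
  using (_≡_; _≢_; refl; sym; trans; cong; cong₂; subst; module ≡-Reasoning)
open import Relation.Nullary using (¬_; Dec; yes; no; ¬?; contradiction)

private variable
  b d i j k m n o r s t B N W : ℕ

coprime-∣ˡ : Coprime m n → d ∣ m → Coprime d n
coprime-∣ˡ m⊥n d∣m (i∣d , i∣n) = m⊥n (∣-trans i∣d d∣m , i∣n)

coprime-∣ʳ : Coprime m n → d ∣ n → Coprime m d
coprime-∣ʳ m⊥n d∣n (i∣m , i∣d) = m⊥n (i∣m , ∣-trans i∣d d∣n)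

coprime-*ʳ : Coprime m n → Coprime m o → Coprime m (n * o)
coprime-*ʳ m⊥n m⊥o (i∣m , i∣n*o) = m⊥o (i∣m , coprime-divisor (coprime-∣ˡ m⊥n i∣m) i∣n*o)

coprime-^ʳ : Coprime m n → ∀ k → Coprime m (n ^ k)
coprime-^ʳ {m} m⊥n zero    = coprime-sym (1-coprimeTo m)
coprime-^ʳ     m⊥n (suc k) = coprime-*ʳ m⊥n (coprime-^ʳ m⊥n k)

coprime-^ : Coprime m n → ∀ k → Coprime (m ^ k) (n ^ k)
coprime-^ m⊥n k = coprime-sym (coprime-^ʳ (coprime-sym (coprime-^ʳ m⊥n k)) k)

coprime-product : ∀ {ns} → All (Coprime m) ns → Coprime m (product ns)
coprime-product {m} []            = coprime-sym (1-coprimeTo m)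
coprime-product     (m⊥n ∷ m⊥ns) = coprime-*ʳ m⊥n (coprime-product m⊥ns)

-- m ∣ n + pred m is the congruence n ≡ 1 (mod m).
∣+pred⇒coprime : .{{NonZero m}} → m ∣ n + pred m → Coprime n m
∣+pred⇒coprime {m} {n} m∣n+m-1 {d} (d∣n , d∣m) = ∣1⇒≡1 (∣m+n∣m⇒∣n d∣m-1+1 d∣m-1)
  where
  d∣m-1 : d ∣ pred m
  d∣m-1 = ∣m+n∣m⇒∣n (∣-trans d∣m m∣n+m-1) d∣n
  d∣m-1+1 : d ∣ pred m + 1
  d∣m-1+1 = subst (d ∣_) (trans (sym (suc-pred m)) (+-comm 1 (pred m))) d∣m

∣o+m∣o+n⇒∣n∸m : ∀ o → m ≤ n → d ∣ o + m → d ∣ o + n → d ∣ n ∸ m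
∣o+m∣o+n⇒∣n∸m {m} {n} {d} o m≤n d∣o+m d∣o+n =
  ∣m+n∣m⇒∣n (subst (d ∣_) o+n≡o+m+[n∸m] d∣o+n) d∣o+m
  where
  o+n≡o+m+[n∸m] : o + n ≡ o + m + (n ∸ m)
  o+n≡o+m+[n∸m] = trans (cong (o +_) (sym (m+[n∸m]≡n m≤n))) (sym (+-assoc o m (n ∸ m)))

∣o+m∣o+n⇒∣∣m-n∣ : ∀ o → d ∣ o + m → d ∣ o + n → d ∣ ∣ m - n ∣
∣o+m∣o+n⇒∣∣m-n∣ {d} {m} {n} o d∣o+m d∣o+n with ≤-total m n
... | inj₁ m≤n = subst (d ∣_) (sym (m≤n⇒∣m-n∣≡n∸m m≤n)) (∣o+m∣o+n⇒∣n∸m o m≤n d∣o+m d∣o+n)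
... | inj₂ n≤m = subst (d ∣_) (sym (m≤n⇒∣n-m∣≡n∸m n≤m)) (∣o+m∣o+n⇒∣n∸m o n≤m d∣o+n d∣o+m)

CoprimeUpTo : ℕ → ℕ → Set
CoprimeUpTo B k = ∀ {e} → 1 ≤ e → e ≤ B → Coprime k e

coprime-to-neighbour : CoprimeUpTo B k → k ∣ o + m → m ≢ n → m ≤ B → n ≤ B → Coprime k (o + n)
coprime-to-neighbour {B} {k} {o} {m} {n} k⊥small k∣o+m m≢n m≤B n≤B (d∣k , d∣o+n) =
  k⊥small 1≤gap gap≤B (d∣k , ∣o+m∣o+n⇒∣∣m-n∣ o (∣-trans d∣k k∣o+m) d∣o+n)
  where
  1≤gap : 1 ≤ ∣ m - n ∣
  1≤gap = n≢0⇒n>0 (m≢n ∘ ∣m-n∣≡0⇒m≡n)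
  gap≤B : ∣ m - n ∣ ≤ B
  gap≤B = ≤-trans (∣m-n∣≤m⊔n m n) (⊔-lub m≤B n≤B)

m∣m^n : 1 ≤ n → m ∣ m ^ n
m∣m^n {suc n} {m} _ = m∣m*n (m ^ n)

m≤m^n : ∀ m → 1 ≤ n → m ≤ m ^ n
m≤m^n         zero      _ = z≤n
m≤m^n {suc n} m@(suc _) _ = m≤m*n m (m ^ n) {{m^n≢0 m n}}

coprime⇒visible : 1 ≤ b → Coprime r s → Visible b (r , s)
coprime⇒visible {b} {r} {s} 1≤b r⊥s = 1∣ r , subst (_∣ s) (sym (^-zeroˡ b)) (1∣ s) , greatest
  where
  greatest : ∀ k → k ∣ r → k ^ b ∣ s → k ≤ 1
  greatest k k∣r k^b∣s = ≤-reflexive (r⊥s (k∣r , ∣-trans (m∣m^n 1≤b) k^b∣s))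

∣⇒invisible : 2 ≤ k → k ∣ r → k ^ b ∣ s → Invisible b (r , s)
∣⇒invisible {k} 2≤k k∣r k^b∣s (_ , _ , greatest) = <⇒≱ 2≤k (greatest k k∣r k^b∣s)

bézout⇒crt : .{{_ : NonZero m}} → ∀ i j → 1 + i * m ≡ j * n →
             ∀ a c → ∃[ x ] m ∣ x + a × n ∣ x + c
bézout⇒crt {m@(suc p)} {n} i j 1+im≡jn a c = x , m∣x+a , n∣x+c
  where
  y : ℕ
  y = p * a + c
  x : ℕ
  x = m * (i * y) + p * a
  m∣x+a : m ∣ x + a
  m∣x+a = subst (m ∣_) (sym (x+a≡ p i a c)) (m∣m*n (i * y + a))
    where
    x+a≡ : ∀ p i a c → (1 + p) * (i * (p * a + c)) + p * a + a ≡ (1 + p) * (i * (p * a + c) + a)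
    x+a≡ = solve-∀
  n∣x+c : n ∣ x + c
  n∣x+c = subst (n ∣_) (sym (trans (x+c≡ p i a c) (cong (_* y) 1+im≡jn))) (n∣m*n*o j y)
    where
    x+c≡ : ∀ p i a c → (1 + p) * (i * (p * a + c)) + p * a + c ≡ (1 + i * (1 + p)) * (p * a + c)
    x+c≡ = solve-∀

crt₂ : .{{_ : NonZero m}} .{{_ : NonZero n}} → Coprime m n →
       ∀ a c → ∃[ x ] 1 ≤ x × m ∣ x + a × n ∣ x + c
crt₂ {m} {n} m⊥n a c = positive (solve (coprime-Bézout m⊥n))
  where
  solve : Bézout.Identity 1 m n → ∃[ x ] m ∣ x + a × n ∣ x + c
  solve (Bézout.-+ i j 1+im≡jn) = bézout⇒crt i j 1+im≡jn a c
  solve (Bézout.+- i j 1+jn≡im) with x , n∣x+c , m∣x+a ← bézout⇒crt j i 1+jn≡im c a =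
    x , m∣x+a , n∣x+c
  shift : ∀ {d} x {a t} → d ∣ x + a → d ∣ t → d ∣ x + t + a
  shift {d} x {a} {t} d∣x+a d∣t = subst (d ∣_) (x+a+t≡x+t+a x a t) (∣m∣n⇒∣m+n d∣x+a d∣t)
    where
    x+a+t≡x+t+a : ∀ x a t → x + a + t ≡ x + t + a
    x+a+t≡x+t+a = solve-∀
  positive : ∃[ x ] m ∣ x + a × n ∣ x + c → ∃[ x ] 1 ≤ x × m ∣ x + a × n ∣ x + c
  positive (x , m∣x+a , n∣x+c) =
    x + m * n , ≤-trans (>-nonZero⁻¹ (m * n) {{m*n≢0 m n}}) (m≤n+m (m * n) x)
              , shift x m∣x+a (m∣m*n n) , shift x n∣x+c (n∣m*n m)

-- The pair (m , a) stands for the congruence x ≡ -a (mod m).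
_solves_ : ℕ → ℕ × ℕ → Set
x solves (m , a) = m ∣ x + a

-- M ∣ x + pred M * y is the congruence x ≡ y (mod M).
≡-mod-solves : ∀ {M x y a} → .{{NonZero M}} → M ∣ x + pred M * y → m ∣ M →
               y solves (m , a) → x solves (m , a)
≡-mod-solves {m} {M@(suc P)} {x} {y} {a} M∣x+Py m∣M m∣y+a =
  ∣m+n∣m⇒∣n (subst (m ∣_) (rearrange x P y a) m∣sum) (∣-trans m∣M (m∣m*n y))
  where
  m∣sum : m ∣ x + P * y + (y + a)
  m∣sum = ∣m∣n⇒∣m+n (∣-trans m∣M M∣x+Py) m∣y+a
  rearrange : ∀ x P y a → x + P * y + (y + a) ≡ (1 + P) * y + (x + a)
  rearrange = solve-∀

solves-∷ : ∀ {cs y} → .{{NonZero m}} → All (NonZero ∘ proj₁) cs → All (Coprime m ∘ proj₁) cs →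
           All (y solves_) cs → ∀ a → ∃[ x ] 1 ≤ x × All (x solves_) ((m , a) ∷ cs)
solves-∷ {m} {cs} {y} cs≢0 m⊥cs y-solves a =
  extend (crt₂ (coprime-product (Allₚ.map⁺ m⊥cs)) a (pred M * y))
  where
  M : ℕ
  M = product (map proj₁ cs)
  instance
    M≢0 : NonZero M
    M≢0 = product≢0 (Allₚ.map⁺ cs≢0)
  extend : ∃[ x ] 1 ≤ x × m ∣ x + a × M ∣ x + pred M * y →
           ∃[ x ] 1 ≤ x × All (x solves_) ((m , a) ∷ cs)
  extend (x , 1≤x , m∣x+a , x≡y) = x , 1≤x , m∣x+a ∷ All.tabulate λ c∈cs →
    ≡-mod-solves x≡y (∈⇒∣product (∈-map⁺ proj₁ c∈cs)) (All.lookup y-solves c∈cs)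

chineseRemainder : (cs : List (ℕ × ℕ)) → All (NonZero ∘ proj₁) cs → AllPairs (Coprime on proj₁) cs →
                   ∃[ x ] 1 ≤ x × All (x solves_) cs
chineseRemainder []             []            []                 = 1 , ≤-refl , []
chineseRemainder ((m , a) ∷ cs) (m≢0 ∷ cs≢0) (m⊥cs ∷ cs-coprime)
  with y , _ , y-solves ← chineseRemainder cs cs≢0 cs-coprime
  = solves-∷ {{m≢0}} cs≢0 m⊥cs y-solves a

n∣n! : ∀ n → 1 ≤ n → n ∣ n !
n∣n! (suc n) _ = m∣m*n (n !)

1+*!-coprimeUpTo : ∀ N i → CoprimeUpTo N (1 + i * N !)
1+*!-coprimeUpTo N i {e} 1≤e e≤N {d} (d∣1+iN! , d∣e) =
  ∣1⇒≡1 (∣m+n∣m⇒∣n (subst (d ∣_) (+-comm 1 (i * N !)) d∣1+iN!) d∣iN!)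
  where
  d∣iN! : d ∣ i * N !
  d∣iN! = ∣-trans d∣e (∣-trans (n∣n! e 1≤e) (∣-trans (m≤n⇒m!∣n! e≤N) (n∣m*n i)))

-- Any common divisor of 1 + i N! and 1 + (i + t) N! divides t.
1+*!-coprime-+ : 1 ≤ t → t ≤ N → Coprime (1 + i * N !) (1 + (i + t) * N !)
1+*!-coprime-+ {t} {N} {i} 1≤t t≤N {d} (d∣A , d∣B) = 1+*!-coprimeUpTo N i 1≤t t≤N (d∣A , d∣t)
  where
  rearrange : ∀ i t F → (i + t) * (1 + i * F) ≡ i * (1 + (i + t) * F) + t
  rearrange = solve-∀
  d∣t : d ∣ t
  d∣t = ∣m+n∣m⇒∣n (subst (d ∣_) (rearrange i t (N !)) (∣-trans d∣A (n∣m*n (i + t))))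
                   (∣-trans d∣B (n∣m*n i))

1+*!-coprime-< : i < j → j ≤ N → Coprime (1 + i * N !) (1 + j * N !)
1+*!-coprime-< {i} {j} {N} i<j j≤N =
  subst (λ j → Coprime (1 + i * N !) (1 + j * N !)) (m+[n∸m]≡n (<⇒≤ i<j))
        (1+*!-coprime-+ {i = i} (m<n⇒0<n∸m i<j) (≤-trans (m∸n≤m j i) j≤N))

1+*!-coprime : i ≢ j → i ≤ N → j ≤ N → Coprime (1 + i * N !) (1 + j * N !)
1+*!-coprime {i} {j} i≢j i≤N j≤N with <-cmp i j
... | tri< i<j _ _ = 1+*!-coprime-< i<j j≤N
... | tri≈ _ i≡j _ = contradiction i≡j i≢j
... | tri> _ _ j<i = coprime-sym (1+*!-coprime-< j<i i≤N)

grid : ℕ → List Point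
grid W = cartesianProduct (upTo (suc W)) (upTo (suc W))

∈-grid⁺ : r ≤ W → s ≤ W → (r , s) ∈ grid W
∈-grid⁺ r≤W s≤W = ∈-cartesianProduct⁺ (∈-upTo⁺ (s≤s r≤W)) (∈-upTo⁺ (s≤s s≤W))

∈-grid⁻ : (r , s) ∈ grid W → r ≤ W × s ≤ W
∈-grid⁻ {W = W} rs∈grid with r∈ , s∈ ← ∈-cartesianProduct⁻ (upTo (suc W)) (upTo (suc W)) rs∈grid =
  ≤-pred (∈-upTo⁻ r∈) , ≤-pred (∈-upTo⁻ s∈)

grid-unique : ∀ W → Unique (grid W)
grid-unique W = Uniqueₚ.cartesianProduct⁺ (Uniqueₚ.upTo⁺ (suc W)) (Uniqueₚ.upTo⁺ (suc W))

cell : ℕ → Point → ℕ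
cell W (r , s) = s + r * suc W

cell-< : r ≤ W → s ≤ W → cell W (r , s) < suc W * suc W
cell-< {r} {W} r≤W s≤W = +-mono-<-≤ (s≤s s≤W) (*-monoˡ-≤ (suc W) r≤W)

cell-injective : ∀ {r s r′ s′} → s ≤ W → s′ ≤ W →
                 cell W (r , s) ≡ cell W (r′ , s′) → (r , s) ≡ (r′ , s′)
cell-injective {W} {r} {s} {r′} {s′} s≤W s′≤W eq = cong₂ _,_ r≡r′ s≡s′
  where
  open ≡-Reasoning
  s≡s′ : s ≡ s′
  s≡s′ = begin
    s                       ≡⟨ m<n⇒m%n≡m (s≤s s≤W) ⟨
    s % suc W               ≡⟨ [m+kn]%n≡m%n s r (suc W) ⟨
    (s + r * suc W) % suc W ≡⟨ cong (_% suc W) eq ⟩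
    (s′ + r′ * suc W) % suc W ≡⟨ [m+kn]%n≡m%n s′ r′ (suc W) ⟩
    s′ % suc W              ≡⟨ m<n⇒m%n≡m (s≤s s′≤W) ⟩
    s′                      ∎
  r≡r′ : r ≡ r′
  r≡r′ = *-cancelʳ-≡ r r′ (suc W)
           (+-cancelˡ-≡ s _ _ (trans eq (cong (_+ r′ * suc W) (sym s≡s′))))

unique⇒allPairs : ∀ {A : Set} {R : A → A → Set} {xs : List A} → Unique xs →
                  (∀ {x y} → x ∈ xs → y ∈ xs → x ≢ y → R x y) → AllPairs R xs
unique⇒allPairs []             R-distinct = []
unique⇒allPairs (x∉xs ∷ xs-unique) R-distinct =
  All.tabulate (λ y∈xs → R-distinct (here refl) (there y∈xs) (All.lookup x∉xs y∈xs))
  ∷ unique⇒allPairs xs-unique (λ x∈xs y∈xs → R-distinct (there x∈xs) (there y∈xs))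

-- K * K ∣ U + K * pred K is the congruence U ≡ K (mod K²).
cofactor-coprime : ∀ {K U} → .{{NonZero K}} → K * K ∣ U + K * pred K →
                   ∃[ U′ ] U ≡ U′ * K × Coprime U′ K
cofactor-coprime {K} {U} K²∣U+K[K-1] = split K∣U
  where
  K∣U : K ∣ U
  K∣U = ∣m+n∣m⇒∣n (subst (K ∣_) (+-comm U (K * pred K)) (∣-trans (m∣m*n K) K²∣U+K[K-1]))
                  (m∣m*n (pred K))
  factor : ∀ U′ K P → U′ * K + K * P ≡ K * (U′ + P)
  factor = solve-∀
  split : K ∣ U → ∃[ U′ ] U ≡ U′ * K × Coprime U′ K
  split (divides U′ U≡U′K) = U′ , U≡U′K , ∣+pred⇒coprime (*-cancelˡ-∣ K K²∣K[U′+[K-1]])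
    where
    K²∣K[U′+[K-1]] : K * K ∣ K * (U′ + pred K)
    K²∣K[U′+[K-1]] = subst (K * K ∣_) (trans (cong (_+ K * pred K) U≡U′K) (factor U′ K (pred K)))
                           K²∣U+K[K-1]

module SingleCircle (b W r₀ s₀ : ℕ) (1≤b : 1 ≤ b) (r₀≤W : r₀ ≤ W) (s₀≤W : s₀ ≤ W) where

  private
    bound : ℕ
    bound = suc W * suc W

    -- Distinct points of grid W get distinct indices 1 ≤ i ≤ bound, so the moduli are ≥ 2 and
    -- pairwise coprime.
    modulus : Point → ℕ
    modulus p = 1 + suc (cell W p) * bound !

    2≤modulus : ∀ p → 2 ≤ modulus p
    2≤modulus p = s≤s (≤-trans (1≤n! bound) (m≤m+n (bound !) (cell W p * bound !)))

    modulus-coprimeUpTo : ∀ p → CoprimeUpTo W (modulus p)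
    modulus-coprimeUpTo p 1≤e e≤W =
      1+*!-coprimeUpTo bound (suc (cell W p)) 1≤e (≤-trans e≤W W≤bound)
      where
      W≤bound : W ≤ bound
      W≤bound = ≤-trans (n≤1+n W) (m≤m*n (suc W) (suc W))

    modulus-coprime : ∀ {p q} → p ∈ grid W → q ∈ grid W → p ≢ q →
                      Coprime (modulus p) (modulus q)
    modulus-coprime {r , s} {r′ , s′} p∈grid q∈grid p≢q
      with r≤W , s≤W ← ∈-grid⁻ p∈grid with r′≤W , s′≤W ← ∈-grid⁻ q∈grid =
      1+*!-coprime (p≢q ∘ cell-injective s≤W s′≤W ∘ suc-injective)
                   (cell-< r≤W s≤W) (cell-< r′≤W s′≤W)

    notCentre? : (p : Point) → Dec (p ≢ (r₀ , s₀))
    notCentre? p = ¬? (≡-dec _≟_ _≟_ p (r₀ , s₀))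

    inColumn? : (p : Point) → Dec (proj₁ p ≡ r₀)
    inColumn? p = proj₁ p ≟ r₀

    others : List Point
    others = filter notCentre? (grid W)

    column : List Point
    column = filter inColumn? others

    offColumn : List Point
    offColumn = filter (¬? ∘ inColumn?) others

    ∈-others⁻ : ∀ {p} → p ∈ others → p ∈ grid W × p ≢ (r₀ , s₀)
    ∈-others⁻ = ∈-filter⁻ notCentre?

    ∈-column⁻ : ∀ {p} → p ∈ column → p ∈ others × proj₁ p ≡ r₀
    ∈-column⁻ = ∈-filter⁻ inColumn?

    ∈-offColumn⁻ : ∀ {p} → p ∈ offColumn → p ∈ others × proj₁ p ≢ r₀
    ∈-offColumn⁻ = ∈-filter⁻ (¬? ∘ inColumn?)

    others-unique : Unique others
    others-unique = Uniqueₚ.filter⁺ notCentre? (grid-unique W)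

    column-or-offColumn : ∀ {p} → p ∈ others → p ∈ column ⊎ p ∈ offColumn
    column-or-offColumn {p} p∈others with inColumn? p
    ... | yes r≡r₀ = inj₁ (∈-filter⁺ inColumn? p∈others r≡r₀)
    ... | no  r≢r₀ = inj₂ (∈-filter⁺ (¬? ∘ inColumn?) p∈others r≢r₀)

    K : ℕ
    K = product (map modulus column)

    instance
      K≢0 : NonZero K
      K≢0 = product≢0 (Allₚ.map⁺ (All.universal (λ _ → _) column))

    offColumn-coprime-K : ∀ {p} → p ∈ offColumn → Coprime (modulus p) K
    offColumn-coprime-K p∈off with p∈others , r≢r₀ ← ∈-offColumn⁻ p∈off =
      coprime-product (Allₚ.map⁺ (All.tabulate λ q∈col →
        let q∈others , q₁≡r₀ = ∈-column⁻ q∈col in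
        modulus-coprime (proj₁ (∈-others⁻ p∈others)) (proj₁ (∈-others⁻ q∈others))
                        (λ p≡q → r≢r₀ (trans (cong proj₁ p≡q) q₁≡r₀))))

    u-system : List (ℕ × ℕ)
    u-system = (K * K , r₀ + K * pred K) ∷ map (λ p → modulus p , proj₁ p) offColumn

    -- Opaque: unfolding the Chinese-remainder witnesses makes type checking very slow.
    opaque
      u-solution : ∃[ u ] 1 ≤ u × All (u solves_) u-system
      u-solution = chineseRemainder u-system
        (m*n≢0 K K ∷ Allₚ.map⁺ (All.universal (λ _ → _) offColumn))
        (Allₚ.map⁺ (All.tabulate λ p∈off →
            coprime-sym (coprime-*ʳ (offColumn-coprime-K p∈off) (offColumn-coprime-K p∈off)))
         ∷ AllPairsₚ.map⁺ (unique⇒allPairs (Uniqueₚ.filter⁺ (¬? ∘ inColumn?) others-unique)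
                            λ p∈off q∈off →
                              modulus-coprime (grid-of-off p∈off) (grid-of-off q∈off)))
        where
        grid-of-off : ∀ {p} → p ∈ offColumn → p ∈ grid W
        grid-of-off = proj₁ ∘ ∈-others⁻ ∘ proj₁ ∘ ∈-offColumn⁻

  u : ℕ
  u = proj₁ u-solution

  1≤u : 1 ≤ u
  1≤u = proj₁ (proj₂ u-solution)

  private
    U : ℕ
    U = u + r₀

    modulus∣u+r : ∀ {p} → p ∈ offColumn → modulus p ∣ u + proj₁ p
    modulus∣u+r p∈off = All.lookup (Allₚ.map⁻ (All.tail (proj₂ (proj₂ u-solution)))) p∈off

    U≡K-mod-K² : K * K ∣ U + K * pred K
    U≡K-mod-K² = subst (K * K ∣_) (sym (+-assoc u r₀ (K * pred K)))
                       (All.head (proj₂ (proj₂ u-solution)))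

    cofactor : ∃[ U′ ] U ≡ U′ * K × Coprime U′ K
    cofactor = cofactor-coprime U≡K-mod-K²

    U′ : ℕ
    U′ = proj₁ cofactor

    U≡U′K : U ≡ U′ * K
    U≡U′K = proj₁ (proj₂ cofactor)

    U′⊥K : Coprime U′ K
    U′⊥K = proj₂ (proj₂ cofactor)

    instance
      U′≢0 : NonZero U′
      U′≢0 = m*n≢0⇒m≢0 U′ {{subst NonZero U≡U′K (>-nonZero (≤-trans 1≤u (m≤m+n u r₀)))}}

    K∣U : K ∣ U
    K∣U = subst (K ∣_) (sym U≡U′K) (n∣m*n U′)

    modulus∣K : ∀ {p} → p ∈ column → modulus p ∣ K
    modulus∣K p∈col = ∈⇒∣product (∈-map⁺ modulus p∈col)

    U′⊥modulus : ∀ {p} → p ∈ others → Coprime U′ (modulus p)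
    U′⊥modulus {p} p∈others with column-or-offColumn p∈others
    ... | inj₁ p∈col = coprime-∣ʳ U′⊥K (modulus∣K p∈col)
    ... | inj₂ p∈off
      with _ , r≢r₀ ← ∈-offColumn⁻ p∈off with r≤W , _ ← ∈-grid⁻ (proj₁ (∈-others⁻ p∈others)) =
      coprime-sym (coprime-∣ʳ modulus⊥U (subst (U′ ∣_) (sym U≡U′K) (m∣m*n K)))
      where
      modulus⊥U : Coprime (modulus p) U
      modulus⊥U = coprime-to-neighbour (modulus-coprimeUpTo p) (modulus∣u+r p∈off) r≢r₀ r≤W r₀≤W

    modulus∣U : ∀ {p} → p ∈ others → modulus p ∣ u + proj₁ p
    modulus∣U {p} p∈others with column-or-offColumn p∈others
    ... | inj₁ p∈col = subst (λ r → modulus p ∣ u + r) (sym (proj₂ (∈-column⁻ p∈col)))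
                             (∣-trans (modulus∣K p∈col) K∣U)
    ... | inj₂ p∈off = modulus∣u+r p∈off

    v-system : List (ℕ × ℕ)
    v-system = (U′ , s₀ + pred U′) ∷ map (λ p → modulus p ^ b , proj₂ p) others

    opaque
      v-solution : ∃[ v ] 1 ≤ v × All (v solves_) v-system
      v-solution = chineseRemainder v-system
        (U′≢0 ∷ Allₚ.map⁺ (All.universal (λ p → m^n≢0 (modulus p) b) others))
        (Allₚ.map⁺ (All.tabulate λ p∈others → coprime-^ʳ (U′⊥modulus p∈others) b)
         ∷ AllPairsₚ.map⁺ (unique⇒allPairs others-unique λ p∈others q∈others p≢q →
             coprime-^ (modulus-coprime (grid-of-others p∈others) (grid-of-others q∈others) p≢q) b))
        where
        grid-of-others : ∀ {p} → p ∈ others → p ∈ grid W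
        grid-of-others = proj₁ ∘ ∈-others⁻

  v : ℕ
  v = proj₁ v-solution

  1≤v : 1 ≤ v
  1≤v = proj₁ (proj₂ v-solution)

  private
    V : ℕ
    V = v + s₀

    modulus^b∣v+s : ∀ {p} → p ∈ others → modulus p ^ b ∣ v + proj₂ p
    modulus^b∣v+s p∈others = All.lookup (Allₚ.map⁻ (All.tail (proj₂ (proj₂ v-solution)))) p∈others

    V⊥U′ : Coprime V U′
    V⊥U′ = ∣+pred⇒coprime (subst (U′ ∣_) (sym (+-assoc v s₀ (pred U′)))
                                 (All.head (proj₂ (proj₂ v-solution))))

    V⊥K : Coprime V K
    V⊥K = coprime-product (Allₚ.map⁺ (All.tabulate V⊥modulus))
      where
      V⊥modulus : ∀ {p} → p ∈ column → Coprime V (modulus p)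
      V⊥modulus {p} p∈col
        with p∈others , r≡r₀ ← ∈-column⁻ p∈col with p∈grid , p≢c ← ∈-others⁻ p∈others
        with _ , s≤W ← ∈-grid⁻ p∈grid =
        coprime-sym (coprime-to-neighbour (modulus-coprimeUpTo p) modulus∣v+s
                                          (λ s≡s₀ → p≢c (cong₂ _,_ r≡r₀ s≡s₀)) s≤W s₀≤W)
        where
        modulus∣v+s : modulus p ∣ v + proj₂ p
        modulus∣v+s = ∣-trans (m∣m^n 1≤b) (modulus^b∣v+s p∈others)

  centre-visible : Visible b (u + r₀ , v + s₀)
  centre-visible =
    coprime⇒visible 1≤b (coprime-sym (subst (Coprime V) (sym U≡U′K) (coprime-*ʳ V⊥U′ V⊥K)))

  others-invisible : ∀ {r s} → r ≤ W → s ≤ W → (r , s) ≢ (r₀ , s₀) →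
                     Invisible b (u + r , v + s)
  others-invisible {r} {s} r≤W s≤W rs≢c =
    ∣⇒invisible {b = b} (2≤modulus (r , s)) (modulus∣U rs∈others) (modulus^b∣v+s rs∈others)
    where
    rs∈others : (r , s) ∈ others
    rs∈others = ∈-filter⁺ notCentre? (∈-grid⁺ r≤W s≤W) rs≢c

singleCircleRealizable : ∀ {b w r₀ s₀} → 1 ≤ b → InBox b w (r₀ , s₀) →
                         SingleCircleRealizable b w (r₀ , s₀)
singleCircleRealizable {b} {w} {r₀} {s₀} 1≤b (_ , r₀≤w , _ , s₀≤wᵇ) =
  (u , v) , (1≤u , 1≤v) , centre-visible ,
  λ r s (_ , r≤w , _ , s≤wᵇ) → others-invisible (≤-trans r≤w w≤wᵇ) s≤wᵇ
  where
  w≤wᵇ : w ≤ w ^ b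
  w≤wᵇ = m≤m^n w 1≤b
  open SingleCircle b (w ^ b) r₀ s₀ 1≤b (≤-trans r₀≤w w≤wᵇ) s₀≤wᵇ

isolated⇒¬connected : ∀ {b p q} → Vertex b p → Vertex b q → p ≢ q →
                      (∀ t → Adjacent p t → ¬ Visible b t) → ¬ Connected b
isolated⇒¬connected p-vertex q-vertex p≢q isolated connected with connected _ _ p-vertex q-vertex
... | here                          = p≢q refl
... | step (_ , visible) adjacent _ = isolated _ adjacent visible

squares≡1 : ∀ m n → m * m + n * n ≡ 1 → (m ≡ 1 × n ≡ 0) ⊎ (m ≡ 0 × n ≡ 1)
squares≡1 0             1             _  = inj₂ (refl , refl)
squares≡1 1             0             _  = inj₁ (refl , refl)
squares≡1 0             0             ()
squares≡1 0             (suc (suc n)) ()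
squares≡1 1             (suc n)       ()
squares≡1 (suc (suc m)) n             ()

∣m-n∣≡1⇒n≡1+m∨m≡1+n : ∀ m n → ∣ m - n ∣ ≡ 1 → n ≡ suc m ⊎ m ≡ suc n
∣m-n∣≡1⇒n≡1+m∨m≡1+n zero    n       eq = inj₁ eq
∣m-n∣≡1⇒n≡1+m∨m≡1+n (suc m) zero    eq = inj₂ eq
∣m-n∣≡1⇒n≡1+m∨m≡1+n (suc m) (suc n) eq with ∣m-n∣≡1⇒n≡1+m∨m≡1+n m n eq
... | inj₁ n≡1+m = inj₁ (cong suc n≡1+m)
... | inj₂ m≡1+n = inj₂ (cong suc m≡1+n)

∣a+2-n∣≡1⇒offset : ∀ a n → ∣ a + 2 - n ∣ ≡ 1 → ∃[ r ] n ≡ a + r × r ≤ 3 × r ≢ 2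
∣a+2-n∣≡1⇒offset a n eq with ∣m-n∣≡1⇒n≡1+m∨m≡1+n (a + 2) n eq
... | inj₁ n≡a+3   = 3 , trans n≡a+3 (sym (+-suc a 2)) , ≤-refl , λ ()
... | inj₂ a+2≡1+n = 1 , suc-injective (trans (sym a+2≡1+n) (+-suc a 1)) , s≤s z≤n , λ ()

adjacent⇒offset : ∀ {u v x y} → Adjacent (u + 2 , v + 2) (x , y) →
                  ∃[ r ] ∃[ s ] x ≡ u + r × y ≡ v + s × r ≤ 3 × s ≤ 3 × (r , s) ≢ (2 , 2)
adjacent⇒offset {u} {v} {x} {y} adjacent with squares≡1 ∣ u + 2 - x ∣ ∣ v + 2 - y ∣ adjacent
... | inj₁ (dx≡1 , dy≡0) with r , x≡u+r , r≤3 , r≢2 ← ∣a+2-n∣≡1⇒offset u x dx≡1 =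
  r , 2 , x≡u+r , sym (∣m-n∣≡0⇒m≡n dy≡0) , r≤3 , s≤s (s≤s z≤n) , r≢2 ∘ cong proj₁
... | inj₂ (dx≡0 , dy≡1) with s , y≡v+s , s≤3 , s≢2 ← ∣a+2-n∣≡1⇒offset v y dy≡1 =
  2 , s , sym (∣m-n∣≡0⇒m≡n dx≡0) , y≡v+s , s≤s (s≤s z≤n) , s≤3 , s≢2 ∘ cong proj₂

¬connected : ∀ {b} → 1 ≤ b → ¬ Connected b
¬connected {b} 1≤b = isolated⇒¬connected centre-vertex corner-vertex centre≢corner isolated
  where
  open SingleCircle b 3 2 2 1≤b (s≤s (s≤s z≤n)) (s≤s (s≤s z≤n))
  centre-vertex : Vertex b (u + 2 , v + 2)
  centre-vertex = (≤-trans 1≤u (m≤m+n u 2) , ≤-trans 1≤v (m≤m+n v 2)) , centre-visible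
  corner-vertex : Vertex b (1 , 1)
  corner-vertex = (≤-refl , ≤-refl) , coprime⇒visible 1≤b (1-coprimeTo 1)
  centre≢corner : (u + 2 , v + 2) ≢ (1 , 1)
  centre≢corner eq with trans (+-comm 2 u) (cong proj₁ eq)
  ... | ()
  isolated : ∀ t → Adjacent (u + 2 , v + 2) t → ¬ Visible b t
  isolated (x , y) adjacent with adjacent⇒offset {u} {v} adjacent
  ... | r , s , refl , refl , r≤3 , s≤3 , rs≢2,2 = others-invisible r≤3 s≤3 rs≢2,2

mainTheorem8 : (b : ℕ) → 1 ≤ b →
    ((w : ℕ) → 1 ≤ w → (r₀ s₀ : ℕ) → InBox b w (r₀ , s₀) →
      SingleCircleRealizable b w (r₀ , s₀))
    × ¬ Connected b
mainTheorem8 b 1≤b = (λ w _ r₀ s₀ → singleCircleRealizable 1≤b) , ¬connected 1≤b
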